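{- Let $k\ge 1$, let $\tau$ be a $k$-ary schema whose function symbols are of arity at most $1$, and let $m\in\mathbb N$. Then there is a function $g\in\Omega(\log^{(k-1)} n)$ such that for every $\tau$-structure $\mathcal S$ with domain $S$ and every linear order $\prec$ on $S$, there is a subset $S'\subseteq S$ of size $g(|S|)$ such that all $\prec$-ordered $k$-tuples over $S'$ are $m$-similar (in $\mathcal S$).
   Context: The schema $\tau$ is the disjoint union of a set $\tau_{\mathrm{rel}}$ of relation symbols (of arity at most $k$) and a set $\tau_{\mathrm{fun}}$ of function symbols (here of arity at most $1$; constants count as $0$-ary functions). $\log^{(j)} n$ is the $j$-fold iterated logarithm ($\log^{(0)}n=n$). A tuple $(a_1,\dots,a_k)$ is $\prec$-ordered if $a_1\prec\dots\prec a_k$. $\mathrm{Terms}^m_\tau$ is the set of terms of nesting depth at most $m$ built from variables and function symbols of $\tau_{\mathrm{fun}}$. For structures $\mathcal S,\mathcal T$ over $\tau$ with domains $S,T$, the $m$-neighborhood $N^m_{\mathcal S}(A)$ of $A\subseteq S$ is the set of values $t^{\mathcal S}(\vec a)$ for $t\in\mathrm{Terms}^m_\tau$ and $\vec a$ over $A$. Sets $A\subseteq S$, $B\subseteq T$ are $m$-similar via $\pi$ if $\pi:N^m_{\mathcal S}(A)\to N^m_{\mathcal T}(B)$ is a bijection such that (i) $\pi$ restricted to $A$ is a bijection onto $B$, (ii) $\pi(t^{\mathcal S}(\vec a))=t^{\mathcal T}(\pi(\vec a))$ for all $t\in\mathrm{Terms}^m_\tau$ and all $\vec a$ over $A$, and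 (iii) $\pi$ preserves the relations of $\tau_{\mathrm{rel}}$ on $N^m_{\mathcal S}(A)$. Two tuples $(a_1,\dots,a_p)$ and $(b_1,\dots,b_p)$ (here both in $\mathcal S$, i.e. $\mathcal T=\mathcal S$) are $m$-similar if $\{a_1,\dots,a_p\}$ and $\{b_1,\dots,b_p\}$ are $m$-similar via a map $\pi$ with $\pi(a_i)=b_i$ for all $i$. -}

module Defs where

open import Level using (0ℓ)
open import Data.Nat using (ℕ; zero; suc; _≤_; _*_; _<_)
open import Data.Nat.Logarithm using (⌊log₂_⌋)
open import Data.Fin using (Fin) renaming (_<_ to _<ᶠ_)
open import Data.Fin.Subset using (Subset; _∈_; ∣_∣)
open import Data.Vec using (Vec; map)
open import Data.Vec.Relation.Unary.All using (All)
open import Data.Bool using (Bool)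
open import Data.Product using (Σ; ∃; ∃-syntax; _×_; _,_)
open import Relation.Binary using (Rel; IsStrictTotalOrder)
open import Relation.Binary.PropositionalEquality using (_≡_)

iterLog : ℕ → ℕ → ℕ
iterLog zero    n = n
iterLog (suc j) n = ⌊log₂ iterLog j n ⌋

BigΩ : (ℕ → ℕ) → (ℕ → ℕ) → Set
BigΩ g f = ∃[ c ] ∃[ N ] (1 ≤ c × (∀ n → N ≤ n → f n ≤ c * g n))

-- A finite schema whose relation symbols have arity ≤ k, with function symbols
-- of arity ≤ 1: nUn unary function symbols and nCon constants.
record Schema (k : ℕ) : Set where
  field
    nRel     : ℕ
    arity    : Fin nRel → ℕ
    arity≤k  : ∀ R → arity R ≤ k
    nUn      : ℕ
    nCon     : ℕ
open Schema public

-- A τ-structure with domain Fin n (|S| = n). Relations as characteristic functions.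
record Structure {k : ℕ} (τ : Schema k) (n : ℕ) : Set where
  field
    rel : (R : Fin (nRel τ)) → Vec (Fin n) (arity τ R) → Bool
    fun : Fin (nUn τ) → Fin n → Fin n
    con : Fin (nCon τ) → Fin n
open Structure public

-- Terms over variable set V of nesting depth ≤ d
-- (depth(x) = 0, depth(c) = 1, depth(f t) = 1 + depth t).
data Term {k : ℕ} (τ : Schema k) (V : Set) : ℕ → Set where
  var : ∀ {d} → V → Term τ V d
  cst : ∀ {d} → Fin (nCon τ) → Term τ V (suc d)
  app : ∀ {d} → Fin (nUn τ) → Term τ V d → Term τ V (suc d)

eval : ∀ {k} {τ : Schema k} {n} {V : Set} {d} →
       Structure τ n → (V → Fin n) → Term τ V d → Fin n
eval 𝒮 ρ (var x)   = ρ x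
eval 𝒮 ρ (cst c)   = con 𝒮 c
eval 𝒮 ρ (app f t) = fun 𝒮 f (eval 𝒮 ρ t)

-- x ∈ N^m(A) where A = {a 1, …, a p}: x is the value of some term of depth ≤ m
-- with variables assigned elements of A.
InNbhd : ∀ {k} {τ : Schema k} {n p} → Structure τ n → ℕ → (Fin p → Fin n) → Fin n → Set
InNbhd {τ = τ} {p = p} 𝒮 m a x = ∃[ t ] (eval {τ = τ} {V = Fin p} {d = m} 𝒮 a t ≡ x)

InSet : ∀ {n p} → (Fin p → Fin n) → Fin n → Set
InSet a x = ∃[ i ] (a i ≡ x)

-- {a i} and {b i} are m-similar via π (π only matters on N^m(A)).
SimilarVia : ∀ {k} {τ : Schema k} {n p} → Structure τ n → ℕ →
             (Fin p → Fin n) → (Fin p → Fin n) → (Fin n → Fin n) → Set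
SimilarVia {τ = τ} {n = n} {p = p} 𝒮 m a b π =
    -- π : N^m(A) → N^m(B) is a bijection
    (∀ x → InNbhd 𝒮 m a x → InNbhd 𝒮 m b (π x))
  × (∀ x y → InNbhd 𝒮 m a x → InNbhd 𝒮 m a y → π x ≡ π y → x ≡ y)
  × (∀ y → InNbhd 𝒮 m b y → ∃[ x ] (InNbhd 𝒮 m a x × π x ≡ y))
    -- (i) π restricted to A is a bijection onto B
  × (∀ x → InSet a x → InSet b (π x))
  × (∀ y → InSet b y → ∃[ x ] (InSet a x × π x ≡ y))
    -- (ii) π (t(a⃗)) = t(π a⃗) for all terms of depth ≤ m and tuples over A
  × (∀ (t : Term τ (Fin p) m) → π (eval 𝒮 a t) ≡ eval 𝒮 (λ i → π (a i)) t)
    -- (iii) π preserves the relations on N^m(A)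
  × (∀ R (xs : Vec (Fin n) (arity τ R)) → All (InNbhd 𝒮 m a) xs →
       rel 𝒮 R xs ≡ rel 𝒮 R (map π xs))

SimilarTuples : ∀ {k} {τ : Schema k} {n p} → Structure τ n → ℕ →
                (Fin p → Fin n) → (Fin p → Fin n) → Set
SimilarTuples 𝒮 m a b = ∃[ π ] (SimilarVia 𝒮 m a b π × (∀ i → π (a i) ≡ b i))

Ordered : ∀ {n p} → Rel (Fin n) 0ℓ → (Fin p → Fin n) → Set
Ordered _≺_ a = ∀ i j → i <ᶠ j → a i ≺ a j

Over : ∀ {n p} → Subset n → (Fin p → Fin n) → Set
Over S' a = ∀ i → a i ∈ S'

module Submission where

-- Lemma 6.4 via Ramsey's theorem.  Write k = j + 1 and colour each k-tuple
-- by its atomic m-type: the truth values of the c atoms t₁ = t₂ and R(t⃗)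
-- over terms of depth ≤ m.  Tuples of equal colour are m-similar, witnessed
-- by the map t(a) ↦ t(b).  Ramsey's theorem for c-bit colourings of
-- increasing k-tuples is proved by induction on j: the Erdős–Rado step
-- greedily builds an end-homogeneous sequence, refining by binary pigeonhole
-- at each point, and colouring j-tuples by their extension with its last
-- point lowers the dimension.  Explicit bounds give a homogeneous s-set among
-- ramseyBound c j s points with iterLog j (ramseyBound c j s) affine in s, so
-- g n = the largest s with ramseyBound c j s ≤ n is Ω(log^(j) n).

open import Defs
open import Level using (0ℓ)
open import Data.Nat using (ℕ; zero; suc; _≤_; _∸_)
open import Data.Fin using (Fin; zero)
open import Data.Fin.Subset using (∣_∣) renaming (⊥ to ∅)
open import Data.Fin.Subset.Properties using (∉⊥; ∣⊥∣≡0)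
open import Data.List using (length)
open import Data.Product using (∃-syntax; _×_; _,_)
open import Data.Sum using (inj₁; inj₂)
open import Data.Empty using (⊥-elim)
open import Relation.Binary using (Rel; IsStrictTotalOrder)
open import Relation.Binary.PropositionalEquality

module ListFacts {A : Set} where

  open import Data.Nat using (ℕ; zero; suc; _+_; _*_; _^_)
  open import Data.Fin as Fin using (Fin)
  open import Data.List using (List; []; _∷_; _++_; length; map; tabulate; cartesianProductWith)
  open import Data.List.Properties using (length-++; length-map)
  open import Data.Nat.Properties using (+-comm; suc-injective)
  open import Data.List.Membership.Propositional using (_∈_)
  open import Data.List.Membership.Propositional.Properties using (∈-cartesianProductWith⁺)
  open import Data.List.Relation.Unary.Any using (here; there)
  open import Data.List.Relation.Unary.AllPairs using (AllPairs; []; _∷_)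
  open import Data.List.Relation.Binary.Sublist.Propositional using (_⊆_; []; _∷_; _∷ʳ_)
  open import Data.List.Relation.Binary.Sublist.Propositional.Properties using (All-resp-⊆)
  open import Data.Vec as Vec using (Vec; toList)
  open import Data.Product using (∃-syntax; _×_; _,_)
  open import Relation.Binary using (Rel)

  length-cartesianProductWith : ∀ {B C : Set} (f : A → B → C) xs ys →
    length (cartesianProductWith f xs ys) ≡ length xs * length ys
  length-cartesianProductWith f [] ys = refl
  length-cartesianProductWith f (x ∷ xs) ys = begin
    length (map (f x) ys ++ cartesianProductWith f xs ys)          ≡⟨ length-++ (map (f x) ys) ⟩
    length (map (f x) ys) + length (cartesianProductWith f xs ys)  ≡⟨ cong₂ _+_ (length-map (f x) ys)
                                                                        (length-cartesianProductWith f xs ys) ⟩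
    length ys + length xs * length ys                              ∎
    where open ≡-Reasoning

  vectorsOver : List A → (j : ℕ) → List (Vec A j)
  vectorsOver P zero    = Vec.[] ∷ []
  vectorsOver P (suc j) = cartesianProductWith Vec._∷_ P (vectorsOver P j)

  length-vectorsOver : ∀ P j → length (vectorsOver P j) ≡ length P ^ j
  length-vectorsOver P zero    = refl
  length-vectorsOver P (suc j) = trans (length-cartesianProductWith Vec._∷_ P (vectorsOver P j))
                                       (cong (length P *_) (length-vectorsOver P j))

  ∈-vectorsOver : ∀ {P j} (v : Vec A j) → (∀ {z} → z ∈ toList v → z ∈ P) → v ∈ vectorsOver P j
  ∈-vectorsOver Vec.[]         _       = here refl
  ∈-vectorsOver (x Vec.∷ v) entries =
    ∈-cartesianProductWith⁺ Vec._∷_ (entries (here refl)) (∈-vectorsOver v (λ z∈v → entries (there z∈v)))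

  ⊆-split : ∀ (as : List A) {x bs O} → as ++ x ∷ bs ⊆ O →
            ∃[ O₁ ] ∃[ O₂ ] (O ≡ O₁ ++ x ∷ O₂ × as ⊆ O₁ × bs ⊆ O₂)
  ⊆-split []       (refl ∷ p) = [] , _ , refl , [] , p
  ⊆-split (a ∷ as) (refl ∷ p) with ⊆-split as p
  ... | O₁ , O₂ , refl , as⊆ , bs⊆ = a ∷ O₁ , O₂ , refl , refl ∷ as⊆ , bs⊆
  ⊆-split []       (y ∷ʳ p) with ⊆-split [] p
  ... | O₁ , O₂ , refl , as⊆ , bs⊆ = y ∷ O₁ , O₂ , refl , y ∷ʳ as⊆ , bs⊆
  ⊆-split (a ∷ as) (y ∷ʳ p) with ⊆-split (a ∷ as) p
  ... | O₁ , O₂ , refl , as⊆ , bs⊆ = y ∷ O₁ , O₂ , refl , y ∷ʳ as⊆ , bs⊆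

  splitLast : ∀ (O : List A) n → length O ≡ suc n →
              ∃[ O₀ ] ∃[ ℓ ] (O ≡ O₀ ++ ℓ ∷ [] × length O₀ ≡ n)
  splitLast (x ∷ [])     zero    refl = [] , x , refl , refl
  splitLast (x ∷ y ∷ O) (suc n) eq with splitLast (y ∷ O) n (suc-injective eq)
  ... | O₀ , ℓ , O≡ , refl = x ∷ O₀ , ℓ , cong (x ∷_) O≡ , refl

  length-snoc : ∀ (P : List A) x → length (P ++ x ∷ []) ≡ suc (length P)
  length-snoc P x = trans (length-++ P) (+-comm (length P) 1)

  toList-tabulate : ∀ {p} (f : Fin p → A) → toList (Vec.tabulate f) ≡ tabulate f
  toList-tabulate {p = zero}  f = refl
  toList-tabulate {p = suc p} f = cong (f Fin.zero ∷_) (toList-tabulate (λ i → f (Fin.suc i)))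

  AllPairs-resp-⊆ : ∀ {R : Rel A 0ℓ} {xs ys} → xs ⊆ ys → AllPairs R ys → AllPairs R xs
  AllPairs-resp-⊆ []         []       = []
  AllPairs-resp-⊆ (y ∷ʳ p)   (_ ∷ rs) = AllPairs-resp-⊆ p rs
  AllPairs-resp-⊆ (refl ∷ p) (r ∷ rs) = All-resp-⊆ p r ∷ AllPairs-resp-⊆ p rs

module Pigeonhole {A : Set} where

  open import Data.Nat using (suc; _+_; _*_; _^_; _≤_; _≤?_)
  open import Data.Nat.Properties using (≤-trans; ≤-reflexive; +-comm; +-suc; +-identityʳ;
    +-monoʳ-≤; *-monoʳ-≤; *-assoc; *-comm; <⇒≤; ≰⇒>; module ≤-Reasoning)
  open import Data.Bool using (Bool; true; false)
  open import Data.List using (List; []; _∷_; length)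
  open import Data.List.Membership.Propositional using (_∈_)
  open import Data.List.Relation.Unary.Any using (here; there)
  open import Data.List.Relation.Unary.All as All using (All; []; _∷_)
  open import Data.List.Relation.Binary.Sublist.Propositional using (_⊆_; []; _∷_; _∷ʳ_; ⊆-refl; ⊆-trans)
  open import Data.List.Relation.Binary.Sublist.Propositional.Properties using (Any-resp-⊆)
  open import Data.Product using (∃-syntax; _×_; _,_)
  open import Relation.Nullary using (yes; no)

  Constant : (A → Bool) → List A → Set
  Constant p ys = ∀ {z z'} → z ∈ ys → z' ∈ ys → p z ≡ p z'

  _Is_On_ : (A → Bool) → Bool → List A → Set
  p Is b On ys = All (λ z → p z ≡ b) ys

  isOn⇒Constant : ∀ {p b ys} → p Is b On ys → Constant p ys
  isOn⇒Constant all z∈ys z'∈ys = trans (All.lookup all z∈ys) (sym (All.lookup all z'∈ys))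

  record Partition (p : A → Bool) (xs : List A) : Set where
    field
      trues falses : List A
      trues⊆      : trues ⊆ xs
      falses⊆     : falses ⊆ xs
      length-sum  : length trues + length falses ≡ length xs
      p-trues     : p Is true On trues
      p-falses    : p Is false On falses

  partition : (p : A → Bool) (xs : List A) → Partition p xs
  partition p [] = record { trues = [] ; falses = [] ; trues⊆ = [] ; falses⊆ = []
                          ; length-sum = refl ; p-trues = [] ; p-falses = [] }
  partition p (x ∷ xs) with p x in px | partition p xs
  ... | true  | P = record
    { trues = x ∷ trues ; falses = falses ; trues⊆ = refl ∷ trues⊆ ; falses⊆ = x ∷ʳ falses⊆
    ; length-sum = cong suc length-sum ; p-trues = px ∷ p-trues ; p-falses = p-falses }
    where open Partition P
  ... | false | P = record
    { trues = trues ; falses = x ∷ falses ; trues⊆ = x ∷ʳ trues⊆ ; falses⊆ = refl ∷ falses⊆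
    ; length-sum = trans (+-suc (length trues) (length falses)) (cong suc length-sum)
    ; p-trues = p-trues ; p-falses = px ∷ p-falses }
    where open Partition P

  sum≤twice-max : ∀ {a b} → b ≤ a → a + b ≤ 2 * a
  sum≤twice-max {a} b≤a = ≤-trans (+-monoʳ-≤ a b≤a) (≤-reflexive (cong (a +_) (sym (+-identityʳ a))))

  halve : (p : A → Bool) (xs : List A) →
          ∃[ ys ] (ys ⊆ xs × length xs ≤ 2 * length ys × Constant p ys)
  halve p xs = longerPart (partition p xs)
    where
      longerPart : Partition p xs → ∃[ ys ] (ys ⊆ xs × length xs ≤ 2 * length ys × Constant p ys)
      longerPart P with length (Partition.falses P) ≤? length (Partition.trues P)
      ... | yes f≤t = trues , trues⊆ , ≤-trans (≤-reflexive (sym length-sum)) (sum≤twice-max f≤t)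
                    , isOn⇒Constant p-trues
        where open Partition P
      ... | no f≰t  = falses , falses⊆
                    , ≤-trans (≤-reflexive (trans (sym length-sum) (+-comm (length trues) (length falses))))
                              (sum≤twice-max (<⇒≤ (≰⇒> f≰t)))
                    , isOn⇒Constant p-falses
        where open Partition P

  refine : (ps : List (A → Bool)) (xs : List A) →
           ∃[ ys ] (ys ⊆ xs × length xs ≤ 2 ^ length ps * length ys ×
                    (∀ {p} → p ∈ ps → Constant p ys))
  refine [] xs = xs , ⊆-refl , ≤-reflexive (sym (+-identityʳ (length xs))) , λ ()
  refine (p ∷ ps) xs with refine ps xs
  ... | ys , ys⊆ , ys-large , ps-const with halve p ys
  ... | zs , zs⊆ , zs-large , p-const = zs , ⊆-trans zs⊆ ys⊆ , size , const
    where
      open ≤-Reasoning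
      size : length xs ≤ 2 ^ length (p ∷ ps) * length zs
      size = begin
        length xs                          ≤⟨ ys-large ⟩
        2 ^ length ps * length ys          ≤⟨ *-monoʳ-≤ (2 ^ length ps) zs-large ⟩
        2 ^ length ps * (2 * length zs)    ≡⟨ sym (*-assoc (2 ^ length ps) 2 (length zs)) ⟩
        2 ^ length ps * 2 * length zs      ≡⟨ cong (_* length zs) (*-comm (2 ^ length ps) 2) ⟩
        2 ^ length (p ∷ ps) * length zs    ∎
      const : ∀ {q} → q ∈ p ∷ ps → Constant q zs
      const (here refl) = p-const
      const (there q∈ps) z∈zs z'∈zs = ps-const q∈ps (Any-resp-⊆ zs⊆ z∈zs) (Any-resp-⊆ zs⊆ z'∈zs)

module Ramsey where

  open import Data.Nat using (ℕ; zero; suc; _*_; _^_; _≤_; s≤s)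
  open import Data.Nat.Properties using (≤-trans; ≤-reflexive; *-cancelˡ-≤; m^n≢0)
  open import Data.Bool using (Bool)
  open import Data.List using (List; []; _∷_; _++_; length; map; cartesianProductWith)
  open import Data.List.Properties using (length-map; ++-assoc; ++-identityʳ)
  open import Data.List.Membership.Propositional using (_∈_)
  open import Data.List.Membership.Propositional.Properties
    using (∈-map⁺; ∈-++⁺ˡ; ∈-++⁺ʳ; ∈-cartesianProductWith⁺)
  open import Data.List.Relation.Unary.Any using (here)
  open import Data.List.Relation.Binary.Sublist.Propositional using (_⊆_; _∷_; ⊆-refl; ⊆-trans; minimum)
  open import Data.List.Relation.Binary.Sublist.Propositional.Properties using (Any-resp-⊆; ++⁺ʳ)
  open import Data.Vec using (Vec; []; _∷_; toList; _∷ʳ_; initLast)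
  open import Data.Vec.Properties using (toList-∷ʳ)
  open import Data.Product using (∃-syntax; _×_; _,_)
  open ListFacts
  open Pigeonhole

  -- A colouring of k-tuples by finitely many bits χ d, d ∈ ds.  The list ys is
  -- homogeneous when every bit is constant on the increasing k-tuples from ys,
  -- i.e. on the vectors whose entries form a sublist of ys.
  Homogeneous : {A D : Set} {k : ℕ} → (D → Vec A k → Bool) → List D → List A → Set
  Homogeneous {A} {k = k} χ ds ys =
    ∀ {v w : Vec A k} → toList v ⊆ ys → toList w ⊆ ys → ∀ {d} → d ∈ ds → χ d v ≡ χ d w

  Homogeneous-resp-⊆ : ∀ {A D : Set} {k} {χ : D → Vec A k → Bool} {ds xs ys} →
                       xs ⊆ ys → Homogeneous χ ds ys → Homogeneous χ ds xs
  Homogeneous-resp-⊆ xs⊆ys hom v⊆ w⊆ = hom (⊆-trans v⊆ xs⊆ys) (⊆-trans w⊆ xs⊆ys)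

  -- erdosRado c j i t points suffice to select t points end-homogeneous for a
  -- c-bit colouring of (j+2)-tuples, when i points have already been selected.
  erdosRado : ℕ → ℕ → ℕ → ℕ → ℕ
  erdosRado c j i zero    = 0
  erdosRado c j i (suc t) = suc (2 ^ (i ^ j * c) * erdosRado c j (suc i) t)

  -- ramseyBound c j s points suffice for a homogeneous set of size s for a
  -- c-bit colouring of (j+1)-tuples.
  ramseyBound : ℕ → ℕ → ℕ → ℕ
  ramseyBound c zero    s = 2 ^ c * s
  ramseyBound c (suc j) s = erdosRado c j 0 (suc (ramseyBound c j s))

  toList-∷ʳ² : ∀ {A : Set} {j} (y : Vec A j) x z → toList ((y ∷ʳ x) ∷ʳ z) ≡ toList y ++ x ∷ z ∷ []
  toList-∷ʳ² y x z = trans (toList-∷ʳ z (y ∷ʳ x))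
                       (trans (cong (_++ z ∷ []) (toList-∷ʳ x y)) (++-assoc (toList y) (x ∷ []) (z ∷ [])))

  module ErdosRadoStep {A D : Set} (j : ℕ) (χ : D → Vec A (suc (suc j)) → Bool) (ds : List D) where

    c : ℕ
    c = length ds

    EndHomogeneous : List A → List A → Set
    EndHomogeneous P O = ∀ O₁ x O₂ (y : Vec A j) → O ≡ O₁ ++ x ∷ O₂ → toList y ⊆ P ++ O₁ →
      ∀ {z z'} → z ∈ O₂ → z' ∈ O₂ → ∀ {d} → d ∈ ds → χ d ((y ∷ʳ x) ∷ʳ z) ≡ χ d ((y ∷ʳ x) ∷ʳ z')

    extensions : List A → A → List (A → Bool)
    extensions P x = cartesianProductWith (λ y d z → χ d ((y ∷ʳ x) ∷ʳ z)) (vectorsOver P j) ds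

    length-extensions : ∀ P x → length (extensions P x) ≡ length P ^ j * c
    length-extensions P x =
      trans (length-cartesianProductWith _ (vectorsOver P j) ds) (cong (_* c) (length-vectorsOver P j))

    ∈-extensions : ∀ {P x d} (y : Vec A j) → (∀ {z} → z ∈ toList y → z ∈ P) → d ∈ ds →
                   (λ z → χ d ((y ∷ʳ x) ∷ʳ z)) ∈ extensions P x
    ∈-extensions y y-over-P d∈ds = ∈-cartesianProductWith⁺ _ (∈-vectorsOver y y-over-P) d∈ds

    -- The count of one step: after taking one point and refining the rest
    -- by the 2^(i^j·c) colour classes of its extensions, enough points remain.
    erdosRado-step : ∀ {i t r r'} → erdosRado c j i (suc t) ≤ suc r →
                     r ≤ 2 ^ (i ^ j * c) * r' → erdosRado c j (suc i) t ≤ r'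
    erdosRado-step {i} (s≤s large) r≤ = *-cancelˡ-≤ (2 ^ (i ^ j * c)) {{m^n≢0 2 (i ^ j * c)}} (≤-trans large r≤)

    endHomogeneous : (t : ℕ) (P xs : List A) → erdosRado c j (length P) t ≤ length xs →
                     ∃[ O ] (O ⊆ xs × length O ≡ t × EndHomogeneous P O)
    endHomogeneous zero P xs _ = [] , minimum xs , refl , λ { [] _ _ _ () ; (_ ∷ _) _ _ _ () }
    endHomogeneous (suc t) P (x ∷ rest) large with refine (extensions P x) rest
    ... | rest' , rest'⊆ , rest'-large , const
      with endHomogeneous t (P ++ x ∷ []) rest'
             (subst (λ i → erdosRado c j i t ≤ length rest') (sym (length-snoc P x))
               (erdosRado-step large
                 (subst (λ e → length rest ≤ 2 ^ e * length rest') (length-extensions P x) rest'-large)))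
    ... | O , O⊆ , refl , O-endHom = x ∷ O , refl ∷ ⊆-trans O⊆ rest'⊆ , refl , extend
      where
        extend : EndHomogeneous P (x ∷ O)
        extend [] _ O₂ y refl y⊆ z∈ z'∈ d∈ =
          const (∈-extensions y (λ z∈y → subst (_ ∈_) (++-identityʳ P) (Any-resp-⊆ y⊆ z∈y)) d∈)
                (Any-resp-⊆ O⊆ z∈) (Any-resp-⊆ O⊆ z'∈)
        extend (_ ∷ O₁) x₁ O₂ y refl y⊆ =
          O-endHom O₁ x₁ O₂ y refl (subst (toList y ⊆_) (sym (++-assoc P (x ∷ []) O₁)) y⊆)

  ramsey : {A D : Set} (j : ℕ) (χ : D → Vec A (suc j) → Bool) (ds : List D) (s : ℕ) (xs : List A) →
           ramseyBound (length ds) j s ≤ length xs →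
           ∃[ ys ] (ys ⊆ xs × s ≤ length ys × Homogeneous χ ds ys)
  ramsey zero χ ds s xs large with refine (map (λ d z → χ d (z ∷ [])) ds) xs
  ... | ys , ys⊆ , ys-large , const = ys , ys⊆ , size , homogeneous
    where
      size : s ≤ length ys
      size = *-cancelˡ-≤ (2 ^ length ds) {{m^n≢0 2 (length ds)}}
               (≤-trans large (subst (λ e → length xs ≤ 2 ^ e * length ys) (length-map _ ds) ys-large))
      homogeneous : Homogeneous χ ds ys
      homogeneous {z ∷ []} {z' ∷ []} z⊆ z'⊆ d∈ =
        const (∈-map⁺ _ d∈) (Any-resp-⊆ z⊆ (here refl)) (Any-resp-⊆ z'⊆ (here refl))
  ramsey {A} (suc j) χ ds s xs large
    with ErdosRadoStep.endHomogeneous j χ ds (suc (ramseyBound (length ds) j s)) [] xs large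
  ... | O , O⊆ , length-O , O-endHom with splitLast O _ length-O
  ... | O₀ , ℓ , refl , length-O₀ with ramsey j (λ d u → χ d (u ∷ʳ ℓ)) ds s O₀ (≤-reflexive (sym length-O₀))
  ... | ys , ys⊆ , ys-large , ys-hom =
    ys , ⊆-trans ys⊆ (⊆-trans (++⁺ʳ (ℓ ∷ []) ⊆-refl) O⊆) , ys-large , homogeneous
    where
      -- ℓ follows every element of ys, so by end-homogeneity the last entry
      -- of a tuple from ys may be replaced by ℓ without changing its colour.
      toLast : ∀ (u : Vec A (suc j)) z → toList (u ∷ʳ z) ⊆ ys → ∀ {d} → d ∈ ds → χ d (u ∷ʳ z) ≡ χ d (u ∷ʳ ℓ)
      toLast u z uz⊆ d∈ with initLast u
      ... | y , x , refl with ⊆-split (toList y) (subst (_⊆ O₀) (toList-∷ʳ² y x z) (⊆-trans uz⊆ ys⊆))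
      ... | O₁ , O₂ , refl , y⊆ , z⊆ =
        O-endHom O₁ x (O₂ ++ ℓ ∷ []) y (++-assoc O₁ (x ∷ O₂) (ℓ ∷ [])) y⊆
          (∈-++⁺ˡ (Any-resp-⊆ z⊆ (here refl))) (∈-++⁺ʳ O₂ (here refl)) d∈

      initial : ∀ (u : Vec A (suc j)) z → toList (u ∷ʳ z) ⊆ ys → toList u ⊆ ys
      initial u z uz⊆ = ⊆-trans (subst (toList u ⊆_) (sym (toList-∷ʳ z u)) (++⁺ʳ (z ∷ []) ⊆-refl)) uz⊆

      homogeneous : Homogeneous χ ds ys
      homogeneous {v} {w} v⊆ w⊆ d∈ with initLast v | initLast w
      ... | u , z , refl | u' , z' , refl =
        trans (toLast u z v⊆ d∈)
              (trans (ys-hom (initial u z v⊆) (initial u' z' w⊆) d∈) (sym (toLast u' z' w⊆ d∈)))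

module Growth where

  open import Data.Nat using (ℕ; zero; suc; _+_; _*_; _^_; _≤_; _<_; z≤n; s≤s; _≤?_; NonZero)
  open import Data.Nat.Properties
  open import Data.Nat.Logarithm using (⌊log₂_⌋; ⌊log₂⌋-mono-≤; ⌊log₂[2^n]⌋≡n)
  open import Data.Nat.Tactic.RingSolver using (solve-∀)
  open import Relation.Nullary using (yes; no)
  open import Data.Empty using (⊥-elim)
  open Ramsey using (erdosRado; ramseyBound)

  log-≤ : ∀ {x} e → x ≤ 2 ^ e → ⌊log₂ x ⌋ ≤ e
  log-≤ e x≤2^e = ≤-trans (⌊log₂⌋-mono-≤ x≤2^e) (≤-reflexive (⌊log₂[2^n]⌋≡n e))

  n<2^n : ∀ n → n < 2 ^ n
  n<2^n zero    = s≤s z≤n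
  n<2^n (suc n) = begin-strict
    suc n          <⟨ s≤s (n<2^n n) ⟩
    suc (2 ^ n)    ≤⟨ +-monoˡ-≤ (2 ^ n) (m^n>0 2 n) ⟩
    2 ^ n + 2 ^ n  ≡⟨ cong (2 ^ n +_) (sym (+-identityʳ (2 ^ n))) ⟩
    2 ^ suc n      ∎
    where open ≤-Reasoning

  ≤2^[1+log] : ∀ x → x ≤ 2 ^ suc ⌊log₂ x ⌋
  ≤2^[1+log] x with x ≤? 2 ^ suc ⌊log₂ x ⌋
  ... | yes x≤ = x≤
  ... | no x≰  = ⊥-elim (<-irrefl refl (begin-strict
    ⌊log₂ x ⌋                        <⟨ n<1+n _ ⟩
    suc ⌊log₂ x ⌋                    ≡⟨ sym (⌊log₂[2^n]⌋≡n (suc ⌊log₂ x ⌋)) ⟩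
    ⌊log₂ 2 ^ suc ⌊log₂ x ⌋ ⌋        ≤⟨ ⌊log₂⌋-mono-≤ (<⇒≤ (≰⇒> x≰)) ⟩
    ⌊log₂ x ⌋                        ∎))
    where open ≤-Reasoning

  iterLog-suc : ∀ j x → iterLog (suc j) x ≡ iterLog j ⌊log₂ x ⌋
  iterLog-suc zero    x = refl
  iterLog-suc (suc j) x = cong ⌊log₂_⌋ (iterLog-suc j x)

  iterLog-mono : ∀ j {x y} → x ≤ y → iterLog j x ≤ iterLog j y
  iterLog-mono zero    x≤y = x≤y
  iterLog-mono (suc j) x≤y = ⌊log₂⌋-mono-≤ (iterLog-mono j x≤y)

  iterLog-≤ : ∀ j x → iterLog j x ≤ x
  iterLog-≤ zero    x = ≤-refl
  iterLog-≤ (suc j) x = ≤-trans (log-≤ (iterLog j x) (<⇒≤ (n<2^n (iterLog j x)))) (iterLog-≤ j x)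

  log-affine : ∀ A B y → ⌊log₂ (A * y + B) ⌋ ≤ ⌊log₂ y ⌋ + A + B + 2
  log-affine A B y = log-≤ (L + A + B + 2) (begin
    A * y + B                        ≤⟨ +-mono-≤ (*-mono-≤ (<⇒≤ (n<2^n A)) (≤2^[1+log] y)) (<⇒≤ (n<2^n B)) ⟩
    2 ^ A * 2 ^ suc L + 2 ^ B        ≡⟨ cong (_+ 2 ^ B) (sym (^-distribˡ-+-* 2 A (suc L))) ⟩
    2 ^ (A + suc L) + 2 ^ B          ≤⟨ +-mono-≤ (^-monoʳ-≤ 2 A+1+L≤M) (^-monoʳ-≤ 2 B≤M) ⟩
    2 ^ M + 2 ^ M                    ≡⟨ cong (2 ^ M +_) (sym (+-identityʳ (2 ^ M))) ⟩
    2 ^ suc M                        ≡⟨ cong (2 ^_) (rearrange L A B) ⟩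
    2 ^ (L + A + B + 2)              ∎)
    where
      open ≤-Reasoning
      L M : ℕ
      L = ⌊log₂ y ⌋
      M = suc (L + A + B)
      A+1+L≤M : A + suc L ≤ M
      A+1+L≤M = ≤-trans (≤-reflexive (trans (+-suc A L) (cong suc (+-comm A L)))) (s≤s (m≤m+n (L + A) B))
      B≤M : B ≤ M
      B≤M = ≤-trans (m≤n+m B (L + A)) (n≤1+n _)
      rearrange : ∀ l a b → suc (suc (l + a + b)) ≡ l + a + b + 2
      rearrange = solve-∀

  -- Additive error incurred by j iterated logarithms of an affine function.
  affineSlack : ℕ → ℕ → ℕ → ℕ
  affineSlack zero    a b = b
  affineSlack (suc j) a b = suc a + affineSlack j a b + 2

  iterLog-affine : ∀ j a b x → iterLog j (suc a * x + b) ≤ suc a * iterLog j x + affineSlack j a b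
  iterLog-affine zero    a b x = ≤-refl
  iterLog-affine (suc j) a b x = begin
    ⌊log₂ iterLog j (suc a * x + b) ⌋  ≤⟨ ⌊log₂⌋-mono-≤ (iterLog-affine j a b x) ⟩
    ⌊log₂ (suc a * y + e) ⌋            ≤⟨ log-affine (suc a) e y ⟩
    ⌊log₂ y ⌋ + suc a + e + 2          ≡⟨ regroup ⌊log₂ y ⌋ a e ⟩
    ⌊log₂ y ⌋ + (suc a + e + 2)        ≤⟨ +-monoˡ-≤ _ (m≤n*m ⌊log₂ y ⌋ (suc a)) ⟩
    suc a * ⌊log₂ y ⌋ + (suc a + e + 2) ∎
    where
      open ≤-Reasoning
      y e : ℕ
      y = iterLog j x
      e = affineSlack j a b
      regroup : ∀ l a e → l + suc a + e + 2 ≡ l + (suc a + e + 2)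
      regroup = solve-∀

  erdosRado-tower : ∀ c j i t → suc (erdosRado c j i t) ≤ 2 ^ ((c * (i + t) ^ j + 1) * t)
  erdosRado-tower c j i zero    = m^n>0 2 ((c * (i + zero) ^ j + 1) * zero)
  erdosRado-tower c j i (suc t) = begin
    1 + 1 + a * E                  ≤⟨ +-monoˡ-≤ (a * E) (+-mono-≤ (m^n>0 2 (i ^ j * c)) (m^n>0 2 (i ^ j * c))) ⟩
    a + a + a * E                  ≤⟨ m≤m+n _ (a * E) ⟩
    a + a + a * E + a * E          ≡⟨ double a E ⟩
    2 * (a * suc E)                ≤⟨ *-monoʳ-≤ 2 (*-mono-≤ a≤ IH) ⟩
    2 * (2 ^ Z * 2 ^ ((Z + 1) * t)) ≡⟨ cong (2 *_) (sym (^-distribˡ-+-* 2 Z ((Z + 1) * t))) ⟩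
    2 ^ suc (Z + (Z + 1) * t)      ≡⟨ cong (2 ^_) (exponent Z t) ⟩
    2 ^ ((Z + 1) * suc t)          ∎
    where
      open ≤-Reasoning
      a E Z : ℕ
      a = 2 ^ (i ^ j * c)
      E = erdosRado c j (suc i) t
      Z = c * (i + suc t) ^ j
      double : ∀ a g → a + a + a * g + a * g ≡ 2 * (a * suc g)
      double = solve-∀
      exponent : ∀ z t → suc (z + (z + 1) * t) ≡ (z + 1) * suc t
      exponent = solve-∀
      a≤ : a ≤ 2 ^ Z
      a≤ = ^-monoʳ-≤ 2 (≤-trans (≤-reflexive (*-comm (i ^ j) c)) (*-monoʳ-≤ c (^-monoˡ-≤ j (m≤m+n i (suc t)))))
      IH : suc E ≤ 2 ^ ((Z + 1) * t)
      IH = subst (λ q → suc E ≤ 2 ^ ((c * q ^ j + 1) * t)) (sym (+-suc i t)) (erdosRado-tower c j (suc i) t)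

  log-erdosRado : ∀ c j T → ⌊log₂ erdosRado c j 0 T ⌋ ≤ (c * T ^ j + 1) * T
  log-erdosRado c j T = log-≤ _ (≤-trans (n≤1+n _) (erdosRado-tower c j 0 T))

  log-polynomial : ∀ c a T .{{_ : NonZero T}} →
                   ⌊log₂ ((c * T ^ a + 1) * T) ⌋ ≤ suc a * ⌊log₂ T ⌋ + (c + suc a)
  log-polynomial c a T = ≤-trans (log-≤ (c + suc L * suc a) (begin
    (c * X + 1) * T                ≤⟨ *-monoˡ-≤ T (+-monoʳ-≤ (c * X) (m^n>0 T a)) ⟩
    (c * X + X) * T                ≡⟨ factor c X T ⟩
    suc c * (T * X)                ≤⟨ *-mono-≤ (n<2^n c) (^-monoˡ-≤ (suc a) (≤2^[1+log] T)) ⟩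
    2 ^ c * (2 ^ suc L) ^ suc a    ≡⟨ cong (2 ^ c *_) (^-*-assoc 2 (suc L) (suc a)) ⟩
    2 ^ c * 2 ^ (suc L * suc a)    ≡⟨ sym (^-distribˡ-+-* 2 c (suc L * suc a)) ⟩
    2 ^ (c + suc L * suc a)        ∎)) (≤-reflexive (regroup c L (suc a)))
    where
      open ≤-Reasoning
      L X : ℕ
      L = ⌊log₂ T ⌋
      X = T ^ a
      factor : ∀ c X T → (c * X + X) * T ≡ suc c * (T * X)
      factor = solve-∀
      regroup : ∀ c l a → c + suc l * a ≡ a * l + (c + a)
      regroup = solve-∀

  -- Coefficients of the affine bound on iterLog j (ramseyBound c j s).
  slope intercept : ℕ → ℕ → ℕ
  slope c zero          = 2 ^ c
  slope c (suc zero)    = (c * 1 + 1) * 2 ^ c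
  slope c (suc (suc j)) = suc (suc j) * slope c (suc j)
  intercept c zero          = 0
  intercept c (suc zero)    = c * 1 + 1
  intercept c (suc (suc j)) =
    suc (suc j) * (intercept c (suc j) + affineSlack (suc j) 0 1) + affineSlack j (suc j) (c + suc (suc j))

  -- One more dimension costs one more logarithm (for j ≥ 1).
  iterLog-ramseyBound-step : ∀ c j s →
    iterLog (suc j) (ramseyBound c (suc j) s) ≤ slope c (suc j) * s + intercept c (suc j) →
    iterLog (suc (suc j)) (ramseyBound c (suc (suc j)) s) ≤ slope c (suc (suc j)) * s + intercept c (suc (suc j))
  iterLog-ramseyBound-step c j s IH = begin
    iterLog (suc (suc j)) R                     ≡⟨ iterLog-suc (suc j) R ⟩
    iterLog (suc j) ⌊log₂ R ⌋                   ≤⟨ iterLog-mono (suc j) (log-erdosRado c (suc j) T) ⟩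
    iterLog (suc j) Q                           ≡⟨ iterLog-suc j Q ⟩
    iterLog j ⌊log₂ Q ⌋                         ≤⟨ iterLog-mono j (log-polynomial c (suc j) T) ⟩
    iterLog j (a * ⌊log₂ T ⌋ + b)               ≤⟨ iterLog-affine j (suc j) b ⌊log₂ T ⌋ ⟩
    a * iterLog j ⌊log₂ T ⌋ + e                 ≡⟨ cong (λ q → a * q + e) (sym (iterLog-suc j T)) ⟩
    a * iterLog (suc j) T + e                   ≤⟨ +-monoˡ-≤ e (*-monoʳ-≤ a T-bound) ⟩
    a * (D * s + E + e′) + e                    ≡⟨ regroup a D s E e′ e ⟩
    a * D * s + (a * (E + e′) + e)              ∎
    where
      open ≤-Reasoning
      a b e e′ D E R′ T R Q : ℕ
      a  = suc (suc j)
      b  = c + a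
      e  = affineSlack j (suc j) b
      e′ = affineSlack (suc j) 0 1
      D  = slope c (suc j)
      E  = intercept c (suc j)
      R′ = ramseyBound c (suc j) s
      T  = suc R′
      R  = erdosRado c (suc j) 0 T
      Q  = (c * T ^ suc j + 1) * T
      regroup : ∀ a D s E e′ e → a * (D * s + E + e′) + e ≡ a * D * s + (a * (E + e′) + e)
      regroup = solve-∀
      successor : ∀ x → suc x ≡ 1 * x + 1
      successor = solve-∀
      T-bound : iterLog (suc j) T ≤ D * s + E + e′
      T-bound = begin
        iterLog (suc j) (suc R′)              ≡⟨ cong (iterLog (suc j)) (successor R′) ⟩
        iterLog (suc j) (1 * R′ + 1)          ≤⟨ iterLog-affine (suc j) 0 1 R′ ⟩
        1 * iterLog (suc j) R′ + e′           ≡⟨ cong (_+ e′) (*-identityˡ _) ⟩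
        iterLog (suc j) R′ + e′               ≤⟨ +-monoˡ-≤ e′ IH ⟩
        D * s + E + e′                        ∎

  iterLog-ramseyBound : ∀ c j s → iterLog j (ramseyBound c j s) ≤ slope c j * s + intercept c j
  iterLog-ramseyBound c zero s = m≤m+n _ 0
  iterLog-ramseyBound c (suc zero) s = begin
    ⌊log₂ erdosRado c 0 0 T ⌋       ≤⟨ log-erdosRado c 0 T ⟩
    (c * 1 + 1) * T                 ≡⟨ expand (c * 1 + 1) (2 ^ c) s ⟩
    (c * 1 + 1) * 2 ^ c * s + (c * 1 + 1) ∎
    where
      open ≤-Reasoning
      T : ℕ
      T = suc (2 ^ c * s)
      expand : ∀ a x s → a * suc (x * s) ≡ a * x * s + a
      expand = solve-∀
  iterLog-ramseyBound c (suc (suc j)) s = iterLog-ramseyBound-step c j s (iterLog-ramseyBound c (suc j) s)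

  erdosRado-≥ : ∀ c j i t → t ≤ erdosRado c j i t
  erdosRado-≥ c j i zero    = z≤n
  erdosRado-≥ c j i (suc t) =
    s≤s (≤-trans (erdosRado-≥ c j (suc i) t) (m≤n*m _ (2 ^ (i ^ j * c)) {{m^n≢0 2 (i ^ j * c)}}))

  ramseyBound-≥ : ∀ c j s → s ≤ ramseyBound c j s
  ramseyBound-≥ c zero    s = m≤n*m s (2 ^ c) {{m^n≢0 2 c}}
  ramseyBound-≥ c (suc j) s = ≤-trans (n≤1+n s) (≤-trans (s≤s (ramseyBound-≥ c j s)) (erdosRado-≥ c j 0 _))

module Inverse (R : ℕ → ℕ) where

  open import Data.Nat using (zero; suc; _+_; _*_; _≤_; z≤n; s≤s; s≤s⁻¹; _≤?_; _≟_)
  open import Data.Nat.Properties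
  open import Data.Nat.Tactic.RingSolver using (solve-∀)
  open import Data.Product using (_,_)
  open import Data.Sum using (_⊎_; inj₁; inj₂)
  open import Data.Empty using (⊥-elim)
  open import Relation.Nullary using (yes; no)

  largestUpTo : ℕ → ℕ → ℕ
  largestUpTo n zero    = 0
  largestUpTo n (suc u) with R (suc u) ≤? n
  ... | yes _ = suc u
  ... | no  _ = largestUpTo n u

  largestUpTo-sound : ∀ n u → largestUpTo n u ≡ 0 ⊎ R (largestUpTo n u) ≤ n
  largestUpTo-sound n zero    = inj₁ refl
  largestUpTo-sound n (suc u) with R (suc u) ≤? n
  ... | yes R≤n = inj₂ R≤n
  ... | no  _   = largestUpTo-sound n u

  largestUpTo-maximal : ∀ n u s → s ≤ u → R s ≤ n → s ≤ largestUpTo n u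
  largestUpTo-maximal n u       zero    _   _   = z≤n
  largestUpTo-maximal n (suc u) (suc s) s≤u R≤n with R (suc u) ≤? n
  ... | yes _ = s≤u
  ... | no R≰n with suc s ≟ suc u
  ...   | yes refl = ⊥-elim (R≰n R≤n)
  ...   | no  s≢u  = largestUpTo-maximal n u (suc s) (s≤s⁻¹ (≤∧≢⇒< s≤u s≢u)) R≤n

  inverse : ℕ → ℕ
  inverse n = largestUpTo n n

  inverse-sound : ∀ n → inverse n ≡ 0 ⊎ R (inverse n) ≤ n
  inverse-sound n = largestUpTo-sound n n

  inverse-maximal : ∀ {n s} → s ≤ n → R s ≤ n → s ≤ inverse n
  inverse-maximal {n} {s} = largestUpTo-maximal n n s

  inverse-positive : (∀ s → s ≤ R s) → ∀ {n} → R 1 ≤ n → 1 ≤ inverse n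
  inverse-positive R≥id R1≤n = inverse-maximal (≤-trans (R≥id 1) R1≤n) R1≤n

  affine-absorb : ∀ D E g → 1 ≤ g → D * suc g + E ≤ suc (D + (D + E)) * g
  affine-absorb D E g 1≤g = begin
    D * suc g + E             ≡⟨ expand D g E ⟩
    D * g + (D + E) * 1       ≤⟨ +-monoʳ-≤ (D * g) (*-monoʳ-≤ (D + E) 1≤g) ⟩
    D * g + (D + E) * g       ≡⟨ collect D E g ⟩
    (D + (D + E)) * g         ≤⟨ m≤n+m _ g ⟩
    suc (D + (D + E)) * g     ∎
    where
      open ≤-Reasoning
      expand : ∀ d g e → d * suc g + e ≡ d * g + (d + e) * 1
      expand = solve-∀
      collect : ∀ d e g → d * g + (d + e) * g ≡ (d + (d + e)) * g
      collect = solve-∀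

  inverse-bigΩ : (f : ℕ → ℕ) → (∀ {x y} → x ≤ y → f x ≤ f y) → (∀ x → f x ≤ x) →
                 (∀ s → s ≤ R s) → ∀ D E → (∀ s → f (R s) ≤ D * s + E) → BigΩ inverse f
  inverse-bigΩ f f-mono f≤id R≥id D E f∘R≤ = suc (D + (D + E)) , R 1 , s≤s z≤n , bound
    where
      bound : ∀ n → R 1 ≤ n → f n ≤ suc (D + (D + E)) * inverse n
      bound n R1≤n with suc (inverse n) ≤? n
      ... | no 1+g≰n = ≤-trans (f≤id n) (≤-trans (s≤s⁻¹ (≰⇒> 1+g≰n)) (m≤n*m (inverse n) (suc (D + (D + E)))))
      ... | yes 1+g≤n with R (suc (inverse n)) ≤? n
      ...   | yes R≤n = ⊥-elim (<-irrefl refl (inverse-maximal 1+g≤n R≤n))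
      ...   | no  R≰n = begin
        f n                                ≤⟨ f-mono (<⇒≤ (≰⇒> R≰n)) ⟩
        f (R (suc (inverse n)))            ≤⟨ f∘R≤ (suc (inverse n)) ⟩
        D * suc (inverse n) + E            ≤⟨ affine-absorb D E (inverse n) (inverse-positive R≥id R1≤n) ⟩
        suc (D + (D + E)) * inverse n      ∎
        where open ≤-Reasoning

module AtomicTypes {k : ℕ} (τ : Schema k) (p m : ℕ) where

  open import Data.Nat using (zero; suc)
  open import Data.Fin using (Fin) renaming (_≟_ to _≟ᶠ_)
  open import Data.Bool using (Bool)
  open import Data.List using (List; []; _∷_; _++_; map; allFin; cartesianProduct; cartesianProductWith; concatMap)
  open import Data.List.Membership.Propositional using (_∈_; lose)
  open import Data.List.Membership.Propositional.Properties
    using (∈-map⁺; ∈-++⁺ˡ; ∈-++⁺ʳ; ∈-allFin; ∈-cartesianProduct⁺; ∈-cartesianProductWith⁺; ∈-concatMap⁺)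
  open import Data.List.Relation.Unary.Any using (any?; satisfied)
  open import Data.Vec as Vec using (Vec)
  open import Data.Vec.Properties using (map-∘; map-cong)
  open import Data.Vec.Relation.Unary.All using (All; []; _∷_)
  open import Data.Product using (Σ; ∃-syntax; _×_; _,_; proj₁; proj₂)
  open import Data.Sum using (_⊎_; inj₁; inj₂)
  open import Data.Empty using (⊥-elim)
  open import Relation.Nullary using (Dec; yes; no; does)
  open ListFacts

  Tm : ℕ → Set
  Tm d = Term τ (Fin p) d

  allTerms : (d : ℕ) → List (Tm d)
  allTerms zero    = map var (allFin p)
  allTerms (suc d) = map var (allFin p) ++ map cst (allFin (nCon τ))
                       ++ cartesianProductWith app (allFin (nUn τ)) (allTerms d)

  ∈-allTerms : ∀ d (t : Tm d) → t ∈ allTerms d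
  ∈-allTerms zero    (var x)   = ∈-map⁺ var (∈-allFin x)
  ∈-allTerms (suc d) (var x)   = ∈-++⁺ˡ (∈-map⁺ var (∈-allFin x))
  ∈-allTerms (suc d) (cst c)   = ∈-++⁺ʳ (map var (allFin p)) (∈-++⁺ˡ (∈-map⁺ cst (∈-allFin c)))
  ∈-allTerms (suc d) (app f t) = ∈-++⁺ʳ (map var (allFin p)) (∈-++⁺ʳ (map cst (allFin (nCon τ)))
    (∈-cartesianProductWith⁺ app (∈-allFin f) (∈-allTerms d t)))

  terms : List (Tm m)
  terms = allTerms m

  -- Atomic formulas over terms of depth ≤ m: equations t₁ = t₂ and R(t⃗).
  Atom : Set
  Atom = (Tm m × Tm m) ⊎ Σ (Fin (nRel τ)) (λ R → Vec (Tm m) (arity τ R))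

  equations : List (Tm m × Tm m)
  equations = cartesianProduct terms terms

  relationalAtoms : Fin (nRel τ) → List (Σ (Fin (nRel τ)) (λ R → Vec (Tm m) (arity τ R)))
  relationalAtoms R = map (R ,_) (vectorsOver terms (arity τ R))

  atoms : List Atom
  atoms = map inj₁ equations ++ map inj₂ (concatMap relationalAtoms (allFin (nRel τ)))

  ∈-atoms-eq : ∀ t₁ t₂ → inj₁ (t₁ , t₂) ∈ atoms
  ∈-atoms-eq t₁ t₂ = ∈-++⁺ˡ (∈-map⁺ inj₁ (∈-cartesianProduct⁺ (∈-allTerms m t₁) (∈-allTerms m t₂)))

  ∈-atoms-rel : ∀ R (ts : Vec (Tm m) (arity τ R)) → inj₂ (R , ts) ∈ atoms
  ∈-atoms-rel R ts = ∈-++⁺ʳ (map inj₁ equations) (∈-map⁺ inj₂ (∈-concatMap⁺ relationalAtoms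
    (lose (∈-allFin R) (∈-map⁺ (R ,_) (∈-vectorsOver ts (λ {t} _ → ∈-allTerms m t))))))

  dec-agree : ∀ {P Q : Set} (p? : Dec P) (q? : Dec Q) → does p? ≡ does q? → P → Q
  dec-agree _        (yes q) _  _  = q
  dec-agree (yes _)  (no _)  () _
  dec-agree (no ¬p)  (no _)  _  p  = ⊥-elim (¬p p)

  module _ {n : ℕ} (𝒮 : Structure τ n) where

    holds : (Fin p → Fin n) → Atom → Bool
    holds a (inj₁ (t₁ , t₂)) = does (eval 𝒮 a t₁ ≟ᶠ eval 𝒮 a t₂)
    holds a (inj₂ (R , ts))  = rel 𝒮 R (Vec.map (eval 𝒮 a) ts)

    SameType : (Fin p → Fin n) → (Fin p → Fin n) → Set
    SameType a b = ∀ {φ} → φ ∈ atoms → holds a φ ≡ holds b φ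

    eval-cong : ∀ {d} {a a′ : Fin p → Fin n} → (∀ i → a i ≡ a′ i) → (t : Term τ (Fin p) d) →
                eval 𝒮 a t ≡ eval 𝒮 a′ t
    eval-cong a≗a′ (var x)   = a≗a′ x
    eval-cong a≗a′ (cst c)   = refl
    eval-cong a≗a′ (app f t) = cong (fun 𝒮 f) (eval-cong a≗a′ t)

    holds-cong : ∀ {a a′ : Fin p → Fin n} → (∀ i → a i ≡ a′ i) → ∀ φ → holds a φ ≡ holds a′ φ
    holds-cong a≗a′ (inj₁ (t₁ , t₂)) rewrite eval-cong a≗a′ t₁ | eval-cong a≗a′ t₂ = refl
    holds-cong a≗a′ (inj₂ (R , ts))  = cong (rel 𝒮 R) (map-cong (eval-cong a≗a′) ts)

    termsFor : ∀ {a : Fin p → Fin n} {l} (xs : Vec (Fin n) l) → All (InNbhd 𝒮 m a) xs →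
               Σ (Vec (Tm m) l) (λ ts → Vec.map (eval 𝒮 a) ts ≡ xs)
    termsFor Vec.[]         []               = Vec.[] , refl
    termsFor (x Vec.∷ xs) ((t , refl) ∷ ps) with termsFor xs ps
    ... | ts , refl = t Vec.∷ ts , refl

    -- Tuples of the same atomic m-type are m-similar: the map t(a) ↦ t(b)
    -- is well defined and injective because the equations between terms
    -- agree, and it preserves relations because the relational atoms agree.
    sameType⇒similar : ∀ a b → SameType a b → SimilarTuples 𝒮 m a b
    sameType⇒similar a b same = π , (into , injective , onto , A→B , A↠B , π-eval , π-rel) , π-var
      where
        transfer : ∀ t₁ t₂ → eval 𝒮 a t₁ ≡ eval 𝒮 a t₂ → eval 𝒮 b t₁ ≡ eval 𝒮 b t₂
        transfer t₁ t₂ =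
          dec-agree (eval 𝒮 a t₁ ≟ᶠ eval 𝒮 a t₂) (eval 𝒮 b t₁ ≟ᶠ eval 𝒮 b t₂) (same (∈-atoms-eq t₁ t₂))

        transfer⁻ : ∀ t₁ t₂ → eval 𝒮 b t₁ ≡ eval 𝒮 b t₂ → eval 𝒮 a t₁ ≡ eval 𝒮 a t₂
        transfer⁻ t₁ t₂ =
          dec-agree (eval 𝒮 b t₁ ≟ᶠ eval 𝒮 b t₂) (eval 𝒮 a t₁ ≟ᶠ eval 𝒮 a t₂) (sym (same (∈-atoms-eq t₁ t₂)))

        π : Fin n → Fin n
        π x with any? (λ t → eval 𝒮 a t ≟ᶠ x) terms
        ... | yes found = eval 𝒮 b (proj₁ (satisfied found))
        ... | no  _     = x

        π-term : ∀ t → π (eval 𝒮 a t) ≡ eval 𝒮 b t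
        π-term t with any? (λ t′ → eval 𝒮 a t′ ≟ᶠ eval 𝒮 a t) terms
        ... | yes found = transfer (proj₁ (satisfied found)) t (proj₂ (satisfied found))
        ... | no  none  = ⊥-elim (none (lose (∈-allTerms m t) refl))

        π-var : ∀ i → π (a i) ≡ b i
        π-var i = π-term (var i)

        into : ∀ x → InNbhd 𝒮 m a x → InNbhd 𝒮 m b (π x)
        into x (t , refl) = t , sym (π-term t)

        injective : ∀ x y → InNbhd 𝒮 m a x → InNbhd 𝒮 m a y → π x ≡ π y → x ≡ y
        injective x y (t₁ , refl) (t₂ , refl) πx≡πy =
          transfer⁻ t₁ t₂ (trans (sym (π-term t₁)) (trans πx≡πy (π-term t₂)))

        onto : ∀ y → InNbhd 𝒮 m b y → ∃[ x ] (InNbhd 𝒮 m a x × π x ≡ y)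
        onto y (t , refl) = eval 𝒮 a t , (t , refl) , π-term t

        A→B : ∀ x → InSet a x → InSet b (π x)
        A→B x (i , refl) = i , sym (π-var i)

        A↠B : ∀ y → InSet b y → ∃[ x ] (InSet a x × π x ≡ y)
        A↠B y (i , refl) = a i , (i , refl) , π-var i

        π-eval : ∀ (t : Tm m) → π (eval 𝒮 a t) ≡ eval 𝒮 (λ i → π (a i)) t
        π-eval t = trans (π-term t) (sym (eval-cong π-var t))

        π-rel : ∀ R (xs : Vec (Fin n) (arity τ R)) → All (InNbhd 𝒮 m a) xs →
                rel 𝒮 R xs ≡ rel 𝒮 R (Vec.map π xs)
        π-rel R xs in-nbhd with termsFor xs in-nbhd
        ... | ts , refl = trans (same (∈-atoms-rel R ts))
                            (cong (rel 𝒮 R) (trans (map-cong (λ t → sym (π-term t)) ts) (map-∘ π (eval 𝒮 a) ts)))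

module FiniteSubsets where

  open import Data.Nat using (suc)
  open import Data.Fin using (Fin; zero; suc)
  open import Data.Fin.Subset using (Subset; ∣_∣; inside; outside; ⊥) renaming (_∈_ to _∈ₛ_; _∉_ to _∉ₛ_)
  open import Data.Fin.Subset.Properties using (∉⊥; ∣⊥∣≡0)
  open import Data.Vec using ([]; _∷_; here; there)
  open import Data.List using (List; []; _∷_; length)
  open import Data.List.Membership.Propositional using (_∈_)
  open import Data.List.Relation.Unary.Any using (here; there)
  open import Data.List.Relation.Unary.All as All using ()
  open import Data.List.Relation.Unary.AllPairs using (_∷_)
  open import Data.List.Relation.Unary.Unique.Propositional using (Unique)
  open import Data.Sum using (_⊎_; inj₁; inj₂)
  open import Data.Empty using (⊥-elim)

  insert : ∀ {n} → Subset n → Fin n → Subset n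
  insert (_ ∷ p) zero    = inside ∷ p
  insert (b ∷ p) (suc y) = b ∷ insert p y

  ∈-insert⁻ : ∀ {n} (p : Subset n) y {x} → x ∈ₛ insert p y → x ≡ y ⊎ x ∈ₛ p
  ∈-insert⁻ (b ∷ p) zero    here      = inj₁ refl
  ∈-insert⁻ (b ∷ p) zero    (there x∈) = inj₂ (there x∈)
  ∈-insert⁻ (b ∷ p) (suc y) here      = inj₂ here
  ∈-insert⁻ (b ∷ p) (suc y) (there x∈) with ∈-insert⁻ p y x∈
  ... | inj₁ refl = inj₁ refl
  ... | inj₂ x∈p  = inj₂ (there x∈p)

  ∣insert∣ : ∀ {n} (p : Subset n) y → y ∉ₛ p → ∣ insert p y ∣ ≡ suc ∣ p ∣
  ∣insert∣ (outside ∷ p) zero    _   = refl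
  ∣insert∣ (inside ∷ p)  zero    y∉p = ⊥-elim (y∉p here)
  ∣insert∣ (outside ∷ p) (suc y) y∉p = ∣insert∣ p y (λ y∈p → y∉p (there y∈p))
  ∣insert∣ (inside ∷ p)  (suc y) y∉p = cong suc (∣insert∣ p y (λ y∈p → y∉p (there y∈p)))

  fromList : ∀ {n} → List (Fin n) → Subset n
  fromList []       = ⊥
  fromList (y ∷ ys) = insert (fromList ys) y

  ∈-fromList⁻ : ∀ {n} (ys : List (Fin n)) {x} → x ∈ₛ fromList ys → x ∈ ys
  ∈-fromList⁻ []       x∈ = ⊥-elim (∉⊥ x∈)
  ∈-fromList⁻ (y ∷ ys) x∈ with ∈-insert⁻ (fromList ys) y x∈
  ... | inj₁ refl = here refl
  ... | inj₂ x∈ys = there (∈-fromList⁻ ys x∈ys)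

  ∣fromList∣ : ∀ {n} (ys : List (Fin n)) → Unique ys → ∣ fromList ys ∣ ≡ length ys
  ∣fromList∣ {n} []       _              = ∣⊥∣≡0 n
  ∣fromList∣     (y ∷ ys) (y∉ys ∷ unique) =
    trans (∣insert∣ (fromList ys) y (λ y∈ → All.lookup y∉ys (∈-fromList⁻ ys y∈) refl))
          (cong suc (∣fromList∣ ys unique))

module Increasing {A : Set} {_<_ : Rel A 0ℓ} (sto : IsStrictTotalOrder _≡_ _<_) where

  open import Data.List using (List; []; _∷_; length)
  open import Data.List.Membership.Propositional using (_∈_)
  open import Data.List.Relation.Unary.Any using (here; there)
  open import Data.List.Relation.Unary.All as All using ()
  open import Data.List.Relation.Unary.AllPairs as AllPairs using (AllPairs; []; _∷_)
  open import Data.List.Relation.Unary.Unique.Propositional using (Unique)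
  open import Data.List.Relation.Unary.Linked.Properties using (Linked⇒AllPairs)
  open import Data.List.Relation.Binary.Sublist.Propositional using (_⊆_; _∷_; _∷ʳ_; minimum)
  open import Data.List.Relation.Binary.Permutation.Propositional using (↭⇒↭ₛ; ↭-sym)
  open import Data.List.Relation.Binary.Permutation.Propositional.Properties using (↭-length)
  import Data.List.Relation.Binary.Permutation.Setoid.Properties as Permutationₛ
  open import Relation.Binary using (DecTotalOrder)
  open import Relation.Binary.PropositionalEquality.Properties using (setoid)
  import Relation.Binary.Construct.StrictToNonStrict as NonStrict
  import Data.List.Sort as Sort
  open import Data.Sum using (inj₁; inj₂)
  open import Data.Product using (_×_; _,_)
  open import Data.Empty using (⊥-elim)
  open import Relation.Nullary using (yes; no)
  open IsStrictTotalOrder sto using (irrefl; _≟_) renaming (trans to <-trans)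

  -- Strictly increasing lists are determined by their elements: an
  -- increasing list whose elements all occur in the increasing list ys is
  -- a sublist of ys.
  increasing-⊆ : (us ys : List A) → AllPairs _<_ us → AllPairs _<_ ys → (∀ {u} → u ∈ us → u ∈ ys) → us ⊆ ys
  increasing-⊆ []       ys       _               _               _    = minimum ys
  increasing-⊆ (u ∷ us) []       _               _               us⊆ with us⊆ (here refl)
  ... | ()
  increasing-⊆ (u ∷ us) (y ∷ ys) (u<us ∷ us-inc) (y<ys ∷ ys-inc) us⊆ with u ≟ y
  ... | yes refl = refl ∷ increasing-⊆ us ys us-inc ys-inc tail⊆
    where
      tail⊆ : ∀ {u′} → u′ ∈ us → u′ ∈ ys
      tail⊆ u′∈us with us⊆ (there u′∈us)
      ... | here refl  = ⊥-elim (irrefl refl (All.lookup u<us u′∈us))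
      ... | there u′∈ = u′∈
  ... | no u≢y = y ∷ʳ increasing-⊆ (u ∷ us) ys (u<us ∷ us-inc) ys-inc below
    where
      u∈ys : u ∈ ys
      u∈ys with us⊆ (here refl)
      ... | here u≡y = ⊥-elim (u≢y u≡y)
      ... | there u∈ = u∈
      -- u occurs later in ys, so y < u ≤ every element of u ∷ us: y is skipped.
      below : ∀ {u′} → u′ ∈ u ∷ us → u′ ∈ ys
      below u′∈ with us⊆ u′∈
      ... | there u′∈ys = u′∈ys
      ... | here refl with u′∈
      ...   | here y≡u    = ⊥-elim (u≢y (sym y≡u))
      ...   | there y∈us = ⊥-elim (irrefl refl (<-trans (All.lookup y<ys u∈ys) (All.lookup u<us y∈us)))

  private
    module ≤ = NonStrict {A = A} _≡_ _<_

    decTotalOrder : DecTotalOrder 0ℓ 0ℓ 0ℓ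
    decTotalOrder = record { isDecTotalOrder = ≤.isDecTotalOrder sto }

  open Sort decTotalOrder public using (sort)
  open Sort decTotalOrder using (sort-↭; sort-↗)
  open DecTotalOrder decTotalOrder using () renaming (trans to ≤-trans)

  sort-increasing : ∀ xs → Unique xs → AllPairs _<_ (sort xs)
  sort-increasing xs unique =
    AllPairs.zipWith strict (Linked⇒AllPairs ≤-trans (sort-↗ xs) ,
      Permutationₛ.Unique-resp-↭ (setoid A) (↭⇒↭ₛ (↭-sym (sort-↭ xs))) unique)
    where
      strict : ∀ {x y} → x ≤.≤ y × x ≢ y → x < y
      strict (inj₁ x<y , _)   = x<y
      strict (inj₂ x≡y , x≢y) = ⊥-elim (x≢y x≡y)

  length-sort : ∀ xs → length (sort xs) ≡ length xs
  length-sort xs = ↭-length (sort-↭ xs)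

module SimilarSubset {k} (τ : Schema k) (m j : ℕ) {n} (𝒮 : Structure τ n)
                     {_≺_ : Rel (Fin n) 0ℓ} (sto : IsStrictTotalOrder _≡_ _≺_) where

  open import Data.Bool using (Bool)
  open import Data.Nat.Properties using (m≤n⇒m⊓n≡m)
  open import Data.List using (List; length; take; allFin)
  open import Data.List.Membership.Propositional using (_∈_)
  open import Data.List.Membership.Propositional.Properties using (∈-tabulate⁻)
  open import Data.List.Properties using (length-take; length-tabulate)
  open import Data.List.Relation.Unary.AllPairs as AllPairs using (AllPairs)
  open import Data.List.Relation.Unary.AllPairs.Properties using (tabulate⁺-<)
  open import Data.List.Relation.Unary.Unique.Propositional.Properties using (allFin⁺)
  open import Data.List.Relation.Binary.Sublist.Propositional using (_⊆_; ⊆-trans)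
  open import Data.List.Relation.Binary.Sublist.Propositional.Properties using (take-⊆)
  open import Data.Vec using (Vec; toList; lookup; tabulate)
  open import Data.Vec.Properties using (lookup∘tabulate)
  open ListFacts
  open Ramsey using (ramsey; ramseyBound; Homogeneous; Homogeneous-resp-⊆)
  open FiniteSubsets using (fromList; ∈-fromList⁻; ∣fromList∣)
  open AtomicTypes τ (suc j) m using (Atom; atoms; holds; holds-cong; sameType⇒similar)
  open Increasing sto using (sort; sort-increasing; length-sort; increasing-⊆)
  open IsStrictTotalOrder sto using (irrefl)

  colour : Atom → Vec (Fin n) (suc j) → Bool
  colour φ v = holds 𝒮 (lookup v) φ

  enum : List (Fin n)
  enum = sort (allFin n)

  enum-increasing : AllPairs _≺_ enum
  enum-increasing = sort-increasing (allFin n) (allFin⁺ n)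

  length-enum : length enum ≡ n
  length-enum = trans (length-sort (allFin n)) (length-tabulate (λ i → i))

  tuple-⊆ : ∀ (zs : List (Fin n)) → AllPairs _≺_ zs → (a : Fin (suc j) → Fin n) →
            Ordered _≺_ a → Over (fromList zs) a → toList (tabulate a) ⊆ zs
  tuple-⊆ zs zs-increasing a a-increasing a-over =
    increasing-⊆ (toList (tabulate a)) zs
      (subst (AllPairs _≺_) (sym (toList-tabulate a)) (tabulate⁺-< (λ {i} {i′} → a-increasing i i′)))
      zs-increasing entry∈zs
    where
      entry∈zs : ∀ {u} → u ∈ toList (tabulate a) → u ∈ zs
      entry∈zs {u} u∈ with ∈-tabulate⁻ {f = a} (subst (u ∈_) (toList-tabulate a) u∈)
      ... | i , refl = ∈-fromList⁻ zs (a-over i)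

  similarSubset : ∀ s → ramseyBound (length atoms) j s ≤ n →
    ∃[ S' ] (∣ S' ∣ ≡ s ×
      (∀ (a b : Fin (suc j) → Fin n) → Ordered _≺_ a → Over S' a → Ordered _≺_ b → Over S' b →
        SimilarTuples 𝒮 m a b))
  similarSubset s large
    with ramsey j colour atoms s enum (subst (ramseyBound (length atoms) j s ≤_) (sym length-enum) large)
  ... | ys , ys⊆ , s≤ys , ys-hom = fromList zs , size , similar
    where
      zs : List (Fin n)
      zs = take s ys
      zs-increasing : AllPairs _≺_ zs
      zs-increasing = AllPairs-resp-⊆ (⊆-trans (take-⊆ s ys) ys⊆) enum-increasing
      zs-hom : Homogeneous colour atoms zs
      zs-hom = Homogeneous-resp-⊆ (take-⊆ s ys) ys-hom
      size : ∣ fromList zs ∣ ≡ s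
      size = trans (∣fromList∣ zs (AllPairs.map (λ x≺y x≡y → irrefl x≡y x≺y) zs-increasing))
                   (trans (length-take s ys) (m≤n⇒m⊓n≡m s≤ys))
      similar : ∀ a b → Ordered _≺_ a → Over (fromList zs) a → Ordered _≺_ b → Over (fromList zs) b →
                SimilarTuples 𝒮 m a b
      similar a b a-inc a-over b-inc b-over = sameType⇒similar 𝒮 a b λ {φ} φ∈ →
        trans (sym (holds-cong 𝒮 (lookup∘tabulate a) φ))
          (trans (zs-hom (tuple-⊆ zs zs-increasing a a-inc a-over) (tuple-⊆ zs zs-increasing b b-inc b-over) φ∈)
                 (holds-cong 𝒮 (lookup∘tabulate b) φ))

lemma6p4 : (k : ℕ) → 1 ≤ k → (τ : Schema k) → (m : ℕ) →
  ∃[ g ] (BigΩ g (iterLog (k ∸ 1)) ×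
    (∀ (n : ℕ) (𝒮 : Structure τ n) (_≺_ : Rel (Fin n) 0ℓ) →
      IsStrictTotalOrder _≡_ _≺_ →
      ∃[ S' ] (∣ S' ∣ ≡ g n ×
        (∀ (a b : Fin k → Fin n) →
          Ordered _≺_ a → Over S' a → Ordered _≺_ b → Over S' b →
          SimilarTuples 𝒮 m a b))))
-- With k = j + 1 and c the number of atoms, g is the discrete inverse of
-- s ↦ ramseyBound c j s.  It is Ω(log^(j) n) by the growth estimate, and an
-- s-element set of similar tuples exists for s = g n: by Ramsey's theorem
-- when ramseyBound c j s ≤ n, and vacuously (the empty set) when g n = 0.
lemma6p4 (suc j) _ τ m = inverse , inverse-Ω , subset
  where
    open Ramsey using (ramseyBound)
    open Growth using (iterLog-mono; iterLog-≤; ramseyBound-≥; slope; intercept; iterLog-ramseyBound)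
    c : ℕ
    c = length (AtomicTypes.atoms τ (suc j) m)
    open Inverse (ramseyBound c j) using (inverse; inverse-sound; inverse-bigΩ)

    inverse-Ω : BigΩ inverse (iterLog j)
    inverse-Ω = inverse-bigΩ (iterLog j) (iterLog-mono j) (iterLog-≤ j) (ramseyBound-≥ c j)
                             (slope c j) (intercept c j) (iterLog-ramseyBound c j)

    subset : ∀ n (𝒮 : Structure τ n) (_≺_ : Rel (Fin n) 0ℓ) → IsStrictTotalOrder _≡_ _≺_ →
             ∃[ S' ] (∣ S' ∣ ≡ inverse n × (∀ (a b : Fin (suc j) → Fin n) →
               Ordered _≺_ a → Over S' a → Ordered _≺_ b → Over S' b → SimilarTuples 𝒮 m a b))
    subset n 𝒮 _≺_ sto with inverse-sound n
    ... | inj₁ none   = ∅ , trans (∣⊥∣≡0 n) (sym none) , λ a _ _ a-over _ _ → ⊥-elim (∉⊥ (a-over zero))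
    ... | inj₂ enough = SimilarSubset.similarSubset τ m j 𝒮 sto (inverse n) enough
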